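{- Let $G$ be a connected word-representable graph whose representation number is $k$. Then every $k$-uniform word representing $G$ is square-free.
   Context: A word $w$ over the alphabet $V$ represents the simple graph $G=(V,E)$ if every letter of $V$ occurs in $w$ and, for all distinct $x,y\in V$, $x$ and $y$ alternate in $w$ (deleting all other letters leaves $xyxy\cdots$ or $yxyx\cdots$) if and only if $xy\in E$. A word is $k$-uniform if every letter occurs in it exactly $k$ times. $G$ is $k$-representable if some $k$-uniform word represents it; the representation number of $G$ is the least $k$ such that $G$ is $k$-representable. A square is a factor $XX$ with $X$ non-empty; a word is square-free if it contains no square. -}

module Defs where

open import Data.Nat using (ℕ; suc; _<_)
open import Data.Fin using (Fin; _≟_)
open import Data.List using (List; []; _∷_; _++_; filter; length)
open import Data.List.Membership.Propositional using (_∈_)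
open import Data.Product using (Σ; _×_; ∃; ∃-syntax)
open import Data.Sum using (_⊎_)
open import Relation.Binary.PropositionalEquality using (_≡_; _≢_)
open import Relation.Nullary using (¬_)
open import Relation.Nullary.Decidable using (_⊎-dec_)

record Graph (n : ℕ) : Set₁ where
  field
    Adj   : Fin n → Fin n → Set
    sym   : ∀ {x y} → Adj x y → Adj y x
    irrefl : ∀ {x} → ¬ Adj x x
open Graph public

Word : ℕ → Set
Word n = List (Fin n)

data Walk {n : ℕ} (G : Graph n) : Fin n → Fin n → Set where
  here : ∀ {x} → Walk G x x
  step : ∀ {x y z} → Adj G x y → Walk G y z → Walk G x z

Connected : ∀ {n} → Graph n → Set
Connected G = ∀ x y → Walk G x y

restrict : ∀ {n} → Fin n → Fin n → Word n → Word n
restrict x y = filter (λ z → (z ≟ x) ⊎-dec (z ≟ y))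

-- AltFrom a b u : u is a prefix of the infinite word a b a b ...
data AltFrom {n : ℕ} (a b : Fin n) : Word n → Set where
  nil  : AltFrom a b []
  cons : ∀ {u} → AltFrom b a u → AltFrom a b (a ∷ u)

Alternate : ∀ {n} → Fin n → Fin n → Word n → Set
Alternate x y w = AltFrom x y (restrict x y w) ⊎ AltFrom y x (restrict x y w)

Represents : ∀ {n} → Word n → Graph n → Set
Represents {n} w G =
  (∀ (x : Fin n) → x ∈ w) ×
  (∀ (x y : Fin n) → x ≢ y → (Alternate x y w → Adj G x y) × (Adj G x y → Alternate x y w))

Uniform : ∀ {n} → ℕ → Word n → Set
Uniform {n} k w = ∀ (x : Fin n) → length (filter (_≟ x) w) ≡ k

Representable : ∀ {n} → ℕ → Graph n → Set
Representable k G = ∃[ w ] (Uniform k w × Represents w G)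

WordRepresentable : ∀ {n} → Graph n → Set
WordRepresentable G = ∃[ w ] Represents w G

RepresentationNumber : ∀ {n} → Graph n → ℕ → Set
RepresentationNumber G k = Representable k G × (∀ m → m < k → ¬ Representable m G)

SquareFree : ∀ {n} → Word n → Set
SquareFree {n} w = ∀ (u X v : Word n) → X ≢ [] → w ≢ u ++ X ++ X ++ v

-- Let w = u X X v be a k-uniform word representing G, with X non-empty. If x and y are
-- adjacent, they alternate in w, and two consecutive copies of X can only both be traversed by
-- an alternation if X contains equally many x's and y's. By connectivity every letter therefore
-- occurs in X the same number m ≥ 1 of times. For such an X, two letters alternate in u X v
-- exactly when they alternate in u X X v, so u X v is a (k − m)-uniform word representing G,
-- contradicting the minimality of k.
module Submission where

open import Defs hiding (sym)
open import Data.Nat using (ℕ; suc; _+_; _∸_; _<_; _≤_; s≤s; z≤n)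
open import Data.Nat.Properties
  using (suc-injective; +-assoc; +-comm; 1+n≢n; <-asym; ≤-reflexive; m+n∸n≡m; m≤n+m; ∸-monoʳ-<)
open import Data.Fin using (Fin; _≟_)
open import Data.List using (List; []; _∷_; _++_; filter; length)
open import Data.List.Properties using (filter-++; length-++; filter-accept; filter-reject)
open import Data.List.Membership.Propositional using (_∈_)
open import Data.List.Membership.Propositional.Properties using (∈-++⁺ˡ; ∈-++⁺ʳ; ∈-++⁻)
open import Data.Product using (_×_; _,_; proj₁; proj₂)
open import Data.Sum using (_⊎_; inj₁; inj₂; swap)
import Data.Sum as Sum
open import Function using (_∘_)
open import Relation.Binary.PropositionalEquality
open import Relation.Nullary using (yes; no; contradiction)
open import Relation.Nullary.Decidable using (_⊎-dec_)
open import Relation.Unary using (Pred; Decidable; _⊆_)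

module _ {a p q} {A : Set a} {P : Pred A p} {Q : Pred A q} (P? : Decidable P) (Q? : Decidable Q) where

  filter-filter-⊆ : P ⊆ Q → ∀ xs → filter P? (filter Q? xs) ≡ filter P? xs
  filter-filter-⊆ P⊆Q []       = refl
  filter-filter-⊆ P⊆Q (x ∷ xs) with Q? x
  ... | no ¬Qx = trans (filter-filter-⊆ P⊆Q xs) (sym (filter-reject P? (¬Qx ∘ P⊆Q)))
  ... | yes _ with P? x
  ...   | yes _ = cong (x ∷_) (filter-filter-⊆ P⊆Q xs)
  ...   | no _  = filter-filter-⊆ P⊆Q xs

module _ {n : ℕ} where

  count : Fin n → Word n → ℕ
  count x w = length (filter (_≟ x) w)

  count-++ : ∀ x (w w′ : Word n) → count x (w ++ w′) ≡ count x w + count x w′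
  count-++ x w w′ = trans (cong length (filter-++ (_≟ x) w w′)) (length-++ (filter (_≟ x) w))

  count-cons-≡ : ∀ c w → count c (c ∷ w) ≡ suc (count c w)
  count-cons-≡ c w = cong length (filter-accept (_≟ c) refl)

  count-cons-≢ : ∀ {c d} → c ≢ d → ∀ w → count d (c ∷ w) ≡ count d w
  count-cons-≢ {d = d} c≢d w = cong length (filter-reject (_≟ d) c≢d)

  count-restrict : ∀ {x y z} → z ≡ x ⊎ z ≡ y → ∀ w → count z (restrict x y w) ≡ count z w
  count-restrict {x} {y} z∈xy w =
    cong length (filter-filter-⊆ (_≟ _) (λ a → (a ≟ x) ⊎-dec (a ≟ y)) (λ { refl → z∈xy }) w)

  restrict-++ : ∀ x y (w w′ : Word n) → restrict x y (w ++ w′) ≡ restrict x y w ++ restrict x y w′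
  restrict-++ x y = filter-++ (λ a → (a ≟ x) ⊎-dec (a ≟ y))

  count-square : ∀ x (u X v : Word n) →
                 count x (u ++ X ++ X ++ v) ≡ count x (u ++ X ++ v) + count x X
  count-square x u X v = begin
    count x (u ++ X ++ X ++ v)            ≡⟨ count-++ x u (X ++ X ++ v) ⟩
    cu + count x (X ++ X ++ v)            ≡⟨ cong (cu +_) (count-++ x X (X ++ v)) ⟩
    cu + (cX + count x (X ++ v))          ≡⟨ cong (λ t → cu + (cX + t)) (count-++ x X v) ⟩
    cu + (cX + (cX + cv))                 ≡⟨ cong (cu +_) (+-comm cX (cX + cv)) ⟩
    cu + ((cX + cv) + cX)                 ≡⟨ +-assoc cu (cX + cv) cX ⟨
    (cu + (cX + cv)) + cX                 ≡⟨ cong (λ t → (cu + t) + cX) (count-++ x X v) ⟨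
    (cu + count x (X ++ v)) + cX          ≡⟨ cong (_+ cX) (count-++ x u (X ++ v)) ⟨
    count x (u ++ X ++ v) + cX            ∎
    where
    open ≡-Reasoning
    cu = count x u
    cX = count x X
    cv = count x v

  Alternating : Fin n → Fin n → Word n → Set
  Alternating c d w = AltFrom c d w ⊎ AltFrom d c w

  data AltSplit (c d : Fin n) (w w′ : Word n) : Set where
    balanced   : AltFrom c d w → count c w ≡ count d w → AltFrom c d w′ → AltSplit c d w w′
    unbalanced : AltFrom c d w → count c w ≡ suc (count d w) → AltFrom d c w′ → AltSplit c d w w′

  altFrom-++⁻ : ∀ {c d} → c ≢ d → ∀ w {w′} → AltFrom c d (w ++ w′) → AltSplit c d w w′
  altFrom-++⁻         c≢d []      h        = balanced nil refl h
  altFrom-++⁻ {c} {d} c≢d (_ ∷ w) (cons h) with altFrom-++⁻ (c≢d ∘ sym) w h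
  ... | balanced hw e hw′   = unbalanced (cons hw) (begin
    count c (c ∷ w)      ≡⟨ count-cons-≡ c w ⟩
    suc (count c w)      ≡⟨ cong suc e ⟨
    suc (count d w)      ≡⟨ cong suc (count-cons-≢ c≢d w) ⟨
    suc (count d (c ∷ w)) ∎) hw′
    where open ≡-Reasoning
  ... | unbalanced hw e hw′ = balanced (cons hw) (begin
    count c (c ∷ w)      ≡⟨ count-cons-≡ c w ⟩
    suc (count c w)      ≡⟨ e ⟨
    count d w            ≡⟨ count-cons-≢ c≢d w ⟨
    count d (c ∷ w)      ∎) hw′
    where open ≡-Reasoning

  altFrom-++⁺ : ∀ {c d} → c ≢ d → ∀ w {w′} → AltSplit c d w w′ → AltFrom c d (w ++ w′)
  altFrom-++⁺         c≢d []      (balanced _ _ hw′)          = hw′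
  altFrom-++⁺ {c} {d} c≢d (_ ∷ w) (balanced (cons hw) e hw′)   =
    cons (altFrom-++⁺ (c≢d ∘ sym) w (unbalanced hw (begin
      count d w            ≡⟨ count-cons-≢ c≢d w ⟨
      count d (c ∷ w)      ≡⟨ e ⟨
      count c (c ∷ w)      ≡⟨ count-cons-≡ c w ⟩
      suc (count c w)      ∎) hw′))
    where open ≡-Reasoning
  altFrom-++⁺ {c} {d} c≢d (_ ∷ w) (unbalanced (cons hw) e hw′) =
    cons (altFrom-++⁺ (c≢d ∘ sym) w (balanced hw (suc-injective (begin
      suc (count d w)       ≡⟨ cong suc (count-cons-≢ c≢d w) ⟨
      suc (count d (c ∷ w)) ≡⟨ e ⟨
      count c (c ∷ w)       ≡⟨ count-cons-≡ c w ⟩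
      suc (count c w)       ∎)) hw′))
    where open ≡-Reasoning

  altFrom-square⁻ : ∀ {c d} → c ≢ d → ∀ R {Q} →
                    AltFrom c d (R ++ R ++ Q) → count c R ≡ count d R × AltFrom c d (R ++ Q)
  altFrom-square⁻ c≢d R h with altFrom-++⁻ c≢d R h
  ... | balanced _ e hRQ   = e , hRQ
  ... | unbalanced _ e hRQ with altFrom-++⁻ (c≢d ∘ sym) R hRQ
  ...   | balanced _ e′ _   = contradiction (sym (trans e′ e)) 1+n≢n
  ...   | unbalanced _ e′ _ = contradiction (≤-reflexive (sym e)) (<-asym (≤-reflexive (sym e′)))

  altFrom-square⁺ : ∀ {c d} → c ≢ d → ∀ R {Q} →
                    count c R ≡ count d R → AltFrom c d (R ++ Q) → AltFrom c d (R ++ R ++ Q)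
  altFrom-square⁺ c≢d R e h with altFrom-++⁻ c≢d R h
  ... | balanced hR _ hQ  = altFrom-++⁺ c≢d R (balanced hR e (altFrom-++⁺ c≢d R (balanced hR e hQ)))
  ... | unbalanced _ e′ _ = contradiction (trans (sym e′) e) 1+n≢n

  altFrom-++⁻ʳ : ∀ {c d} (w : Word n) {w′} → AltFrom c d (w ++ w′) → Alternating c d w′
  altFrom-++⁻ʳ []      h        = inj₁ h
  altFrom-++⁻ʳ (_ ∷ w) (cons h) with altFrom-++⁻ʳ w h
  ... | inj₁ h′ = inj₂ h′
  ... | inj₂ h′ = inj₁ h′

  altFrom-mapSuffix : ∀ {c d} (w : Word n) {S T} →
                      (AltFrom c d S → AltFrom c d T) → (AltFrom d c S → AltFrom d c T) →
                      AltFrom c d (w ++ S) → AltFrom c d (w ++ T)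
  altFrom-mapSuffix []      f g h        = f h
  altFrom-mapSuffix (_ ∷ w) f g (cons h) = cons (altFrom-mapSuffix w g f h)

  alternating-++⁻ʳ : ∀ {c d} (w : Word n) {w′} → Alternating c d (w ++ w′) → Alternating c d w′
  alternating-++⁻ʳ w (inj₁ h) = altFrom-++⁻ʳ w h
  alternating-++⁻ʳ w (inj₂ h) = swap (altFrom-++⁻ʳ w h)

  alternating-square⇒balanced : ∀ {c d} → c ≢ d → ∀ P R {Q} →
                                Alternating c d (P ++ R ++ R ++ Q) → count c R ≡ count d R
  alternating-square⇒balanced c≢d P R h with alternating-++⁻ʳ P h
  ... | inj₁ h′ = proj₁ (altFrom-square⁻ c≢d R h′)
  ... | inj₂ h′ = sym (proj₁ (altFrom-square⁻ (c≢d ∘ sym) R h′))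

  alternating-unsquare : ∀ {c d} → c ≢ d → ∀ P R {Q} →
                         Alternating c d (P ++ R ++ R ++ Q) → Alternating c d (P ++ R ++ Q)
  alternating-unsquare {c} {d} c≢d P R {Q} =
    Sum.map (altFrom-mapSuffix P unsquare⁺ unsquare⁻) (altFrom-mapSuffix P unsquare⁻ unsquare⁺)
    where
    unsquare⁺ : AltFrom c d (R ++ R ++ Q) → AltFrom c d (R ++ Q)
    unsquare⁺ = proj₂ ∘ altFrom-square⁻ c≢d R
    unsquare⁻ : AltFrom d c (R ++ R ++ Q) → AltFrom d c (R ++ Q)
    unsquare⁻ = proj₂ ∘ altFrom-square⁻ (c≢d ∘ sym) R

  alternating-square : ∀ {c d} → c ≢ d → ∀ P R {Q} → count c R ≡ count d R →
                       Alternating c d (P ++ R ++ Q) → Alternating c d (P ++ R ++ R ++ Q)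
  alternating-square {c} {d} c≢d P R {Q} e =
    Sum.map (altFrom-mapSuffix P square⁺ square⁻) (altFrom-mapSuffix P square⁻ square⁺)
    where
    square⁺ : AltFrom c d (R ++ Q) → AltFrom c d (R ++ R ++ Q)
    square⁺ = altFrom-square⁺ c≢d R e
    square⁻ : AltFrom d c (R ++ Q) → AltFrom d c (R ++ R ++ Q)
    square⁻ = altFrom-square⁺ (c≢d ∘ sym) R (sym e)

  restrict-++³ : ∀ x y (u X v : Word n) →
                 restrict x y (u ++ X ++ v) ≡ restrict x y u ++ restrict x y X ++ restrict x y v
  restrict-++³ x y u X v =
    trans (restrict-++ x y u (X ++ v)) (cong (restrict x y u ++_) (restrict-++ x y X v))

  restrict-square : ∀ x y (u X v : Word n) →
                    restrict x y (u ++ X ++ X ++ v) ≡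
                    restrict x y u ++ restrict x y X ++ restrict x y X ++ restrict x y v
  restrict-square x y u X v =
    trans (restrict-++³ x y u X (X ++ v))
          (cong (λ t → restrict x y u ++ restrict x y X ++ t) (restrict-++ x y X v))

  module _ {x y : Fin n} (x≢y : x ≢ y) (u X v : Word n) where

    alternate-square⇒balanced : Alternate x y (u ++ X ++ X ++ v) → count x X ≡ count y X
    alternate-square⇒balanced h = begin
      count x X                 ≡⟨ count-restrict (inj₁ refl) X ⟨
      count x (restrict x y X)  ≡⟨ alternating-square⇒balanced x≢y (restrict x y u) (restrict x y X)
                                     (subst (Alternating x y) (restrict-square x y u X v) h) ⟩
      count y (restrict x y X)  ≡⟨ count-restrict (inj₂ refl) X ⟩
      count y X                 ∎
      where open ≡-Reasoning

    alternate-unsquare : Alternate x y (u ++ X ++ X ++ v) → Alternate x y (u ++ X ++ v)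
    alternate-unsquare h = subst (Alternating x y) (sym (restrict-++³ x y u X v))
      (alternating-unsquare x≢y (restrict x y u) (restrict x y X)
        (subst (Alternating x y) (restrict-square x y u X v) h))

    alternate-square : count x X ≡ count y X →
                       Alternate x y (u ++ X ++ v) → Alternate x y (u ++ X ++ X ++ v)
    alternate-square e h = subst (Alternating x y) (sym (restrict-square x y u X v))
      (alternating-square x≢y (restrict x y u) (restrict x y X) balanced-restriction
        (subst (Alternating x y) (restrict-++³ x y u X v) h))
      where
      balanced-restriction : count x (restrict x y X) ≡ count y (restrict x y X)
      balanced-restriction =
        trans (count-restrict (inj₁ refl) X) (trans e (sym (count-restrict (inj₂ refl) X)))

  ∈-unsquare : ∀ {x} (u X v : Word n) → x ∈ u ++ X ++ X ++ v → x ∈ u ++ X ++ v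
  ∈-unsquare u X v x∈w with ∈-++⁻ u x∈w
  ... | inj₁ x∈u = ∈-++⁺ˡ x∈u
  ... | inj₂ x∈XXv with ∈-++⁻ X x∈XXv
  ...   | inj₁ x∈X  = ∈-++⁺ʳ u (∈-++⁺ˡ x∈X)
  ...   | inj₂ x∈Xv = ∈-++⁺ʳ u x∈Xv

  uniform-unsquare : ∀ {k m} (u X v : Word n) → Uniform k (u ++ X ++ X ++ v) →
                     (∀ x → count x X ≡ m) → Uniform (k ∸ m) (u ++ X ++ v)
  uniform-unsquare {k} {m} u X v unif X-regular x = begin
    count x (u ++ X ++ v)                 ≡⟨ m+n∸n≡m _ m ⟨
    count x (u ++ X ++ v) + m ∸ m         ≡⟨ cong (λ t → count x (u ++ X ++ v) + t ∸ m) (X-regular x) ⟨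
    count x (u ++ X ++ v) + count x X ∸ m ≡⟨ cong (_∸ m) (count-square x u X v) ⟨
    count x (u ++ X ++ X ++ v) ∸ m        ≡⟨ cong (_∸ m) (unif x) ⟩
    k ∸ m                                 ∎
    where open ≡-Reasoning

  module _ (G : Graph n) (u X v : Word n) (rep : Represents (u ++ X ++ X ++ v) G) where

    walk⇒balanced : ∀ {x y} → Walk G x y → count x X ≡ count y X
    walk⇒balanced here                = refl
    walk⇒balanced (step {x} {y} xy p) =
      trans (alternate-square⇒balanced x≢y u X v (proj₂ (proj₂ rep x y x≢y) xy)) (walk⇒balanced p)
      where
      x≢y : x ≢ y
      x≢y refl = irrefl G xy

    represents-unsquare : ∀ {m} → (∀ x → count x X ≡ m) → Represents (u ++ X ++ v) G
    represents-unsquare X-regular =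
      (λ x → ∈-unsquare u X v (proj₁ rep x)) ,
      λ x y x≢y → (proj₁ (proj₂ rep x y x≢y) ∘ alternate-square x≢y u X v (X-balanced x y)) ,
                  (alternate-unsquare x≢y u X v ∘ proj₂ (proj₂ rep x y x≢y))
      where
      X-balanced : ∀ x y → count x X ≡ count y X
      X-balanced x y = trans (X-regular x) (sym (X-regular y))

mainTheorem4 : ∀ (n : ℕ) (G : Graph n) (k : ℕ) →
    Connected G → WordRepresentable G → RepresentationNumber G k →
    ∀ (w : Word n) → Uniform k w → Represents w G → SquareFree w
mainTheorem4 n G k conn _ _             w unif rep u []      v X≢[] _    = X≢[] refl
mainTheorem4 n G k conn _ (_ , minimal) w unif rep u (z ∷ Y) v _    refl =
  minimal (k ∸ m) (∸-monoʳ-< 0<m m≤k)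
    ( u ++ X ++ v
    , uniform-unsquare {k = k} u X v unif X-regular
    , represents-unsquare G u X v rep X-regular )
  where
  X : Word n
  X = z ∷ Y
  m : ℕ
  m = count z X
  X-regular : ∀ x → count x X ≡ m
  X-regular x = walk⇒balanced G u X v rep (conn x z)
  0<m : 0 < m
  0<m = subst (0 <_) (sym (count-cons-≡ z Y)) (s≤s z≤n)
  m≤k : m ≤ k
  m≤k = subst (m ≤_) (trans (sym (count-square z u X v)) (unif z)) (m≤n+m m _)
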